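{- Let $(G,c,k)$ be an instance of \textsc{Multi-STC} and let $A\subseteq\mathscr{P}$ be a periphery component such that there exists an edge $\{u,v\}\in E(A)$ which forms an induced $P_3$ (induced path on three vertices) with fewer than $c$ other edges of $G$. Then $A$ is good.
   Context: A $c$-colored labeling of $G=(V,E)$ is a partition $L=(S^1_L,\dots,S^c_L,W_L)$ of $E$; it is an STC-labeling if there are no $\{u,v\},\{v,w\}\in S^i_L$ ($u\ne w$) with $\{u,w\}\notin E$. Fix $D\subseteq E$ such that $(V,E\setminus D)$ has maximum degree at most $\lfloor c/2\rfloor+1$; the core $\mathscr{C}$ is the set of vertices incident with an edge of $D$, $\mathscr{P}=V\setminus\mathscr{C}$, and a periphery component is the vertex set of a connected component of $G[\mathscr{P}]$. $E(A)$ denotes edges with both endpoints in $A$. Labelings $L,L'$ are partially equal on $E'$ if for all $e\in E'$ and all $i$, $e\in S^i_L\iff e\in S^i_{L'}$. A periphery component $A$ is good if for every STC-labeling $L$ of $G$ with $E(A)\subseteq W_L$ there is an STC-labeling $L'$ partially equal to $L$ on $E\setminus E(A)$ with $W_{L'}\cap E(A)=\emptyset$. -}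

module Defs where

open import Data.Nat using (ℕ; _≤_; _<_; _+_)
open import Data.Nat.DivMod using (_/_)
open import Data.Fin using (Fin; _≟_)
open import Data.Bool using (Bool; true; false; _∧_; not)
open import Data.List using (List; length; filter; allFin)
open import Data.Maybe using (Maybe; just; nothing)
open import Data.Product using (Σ; _×_; ∃)
open import Relation.Nullary using (¬_; does)
open import Relation.Binary.PropositionalEquality using (_≡_; _≢_)

record Graph (n : ℕ) : Set where
  field
    adj     : Fin n → Fin n → Bool
    adj-sym : ∀ u v → adj u v ≡ adj v u
    adj-irr : ∀ v → adj v v ≡ false
open Graph public

Edge : ∀ {n} → Graph n → Fin n → Fin n → Set
Edge G u v = adj G u v ≡ true

count : ∀ {n} → (Fin n → Bool) → ℕ
count {n} p = length (filter (λ w → p w Data.Bool.≟ true) (allFin n))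

-- A c-colored labeling: each edge {u,v} gets `just i` (edge in S^{i+1}_L)
-- or `nothing` (edge in W_L).  The value is symmetric in u, v; its values
-- on non-edges are irrelevant (never inspected).
record Labeling (n c : ℕ) : Set where
  field
    lab     : Fin n → Fin n → Maybe (Fin c)
    lab-sym : ∀ u v → lab u v ≡ lab v u
open Labeling public

IsSTC : ∀ {n c} → Graph n → Labeling n c → Set
IsSTC {n} {c} G L =
  ∀ (u v w : Fin n) (i : Fin c) → u ≢ w →
  Edge G u v → Edge G v w →
  lab L u v ≡ just i → lab L v w ≡ just i → Edge G u w

record EdgeSubset {n} (G : Graph n) : Set where
  field
    mem     : Fin n → Fin n → Bool
    mem-sym : ∀ u v → mem u v ≡ mem v u
    mem-sub : ∀ u v → mem u v ≡ true → Edge G u v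
open EdgeSubset public

degMinus : ∀ {n} (G : Graph n) → EdgeSubset G → Fin n → ℕ
degMinus G D v = count (λ w → adj G v w ∧ not (mem D v w))

ValidD : ∀ {n} (G : Graph n) → ℕ → EdgeSubset G → Set
ValidD G c D = ∀ v → degMinus G D v ≤ c / 2 + 1

InCore : ∀ {n} {G : Graph n} → EdgeSubset G → Fin n → Set
InCore {n} D v = ∃ λ (w : Fin n) → mem D v w ≡ true

InPeriphery : ∀ {n} {G : Graph n} → EdgeSubset G → Fin n → Set
InPeriphery D v = ¬ InCore D v

data Reach {n} (G : Graph n) (P : Fin n → Set) (a : Fin n) : Fin n → Set where
  here : P a → Reach G P a a
  step : ∀ {b d} → Reach G P a b → Edge G b d → P d → Reach G P a d

record PeripheryComponent {n} (G : Graph n) (D : EdgeSubset G)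
                          (A : Fin n → Set) : Set where
  field
    nonempty  : ∃ A
    sub       : ∀ v → A v → InPeriphery D v
    connected : ∀ a b → A a → A b → Reach G (InPeriphery D) a b
    maximal   : ∀ a b → A a → InPeriphery D b → Reach G (InPeriphery D) a b → A b

PartiallyEqualOutside : ∀ {n c} (G : Graph n) (A : Fin n → Set) →
                        Labeling n c → Labeling n c → Set
PartiallyEqualOutside G A L L' =
  ∀ u v → Edge G u v → ¬ (A u × A v) → lab L u v ≡ lab L' u v

Good : ∀ {n} (G : Graph n) (c : ℕ) (A : Fin n → Set) → Set
Good {n} G c A =
  ∀ (L : Labeling n c) → IsSTC G L →
  (∀ u v → Edge G u v → A u → A v → lab L u v ≡ nothing) →
  Σ (Labeling n c) λ L' → IsSTC G L' × PartiallyEqualOutside G A L L' ×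
    (∀ u v → Edge G u v → A u → A v → lab L' u v ≢ nothing)

-- number of edges e' ∈ E forming an induced P3 with {u,v}:
-- edges {v,w} with w ≠ u, {u,w} ∉ E, and edges {u,w} with w ≠ v, {v,w} ∉ E.
p3Count : ∀ {n} → Graph n → Fin n → Fin n → ℕ
p3Count G u v =
  count (λ w → adj G v w ∧ not (adj G u w) ∧ not (does (w ≟ u))) +
  count (λ w → adj G u w ∧ not (adj G v w) ∧ not (does (w ≟ v)))

module Submission where

-- Every vertex of A lies in the periphery, so it has degree at most ⌊c/2⌋+1.
-- Let ℓ be the breadth-first level in G[𝒫] measured from the two ends of
-- {u,v}, and rank an edge {x,y} by ℓ x + ℓ y; then {u,v} is the only edge of
-- rank 0, and every other edge of E(A) meets an edge of E(A) of smaller rank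
-- at its lower end (`lower-edge`).  Starting from L we colour the weak edges
-- of E(A) greedily, in order of decreasing rank.  When {x,y} is coloured,
-- all edges ranked below it are still weak, so fewer than c coloured edges
-- form an induced P3 with {x,y}: for {x,y} = {u,v} by hypothesis, otherwise
-- because one neighbouring edge is weak and the degree bound leaves at most
-- (⌊c/2⌋ - 1) + ⌊c/2⌋ of them.  A colour used by none of them exists by
-- pigeonhole, and giving it to {x,y} keeps the labeling STC.

open import Defs
open import Data.Nat using (ℕ; zero; suc; _+_; _*_; _≤_; _<_; _/_; z≤n; s≤s; s≤s⁻¹; z<s)
open import Data.Nat.Properties hiding (_≟_)
open import Data.Nat.DivMod using (m/n*n≤m)
open import Data.Fin using (Fin; _≟_)
open import Data.Fin.Properties using (any?; injective⇒≤)
open import Data.Bool using (Bool; true; false; _∧_; _∨_; not; if_then_else_)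
import Data.Bool as Bool
open import Data.Bool.Properties using (¬-not; ∨-zeroʳ; ∧-zeroʳ)
open import Data.Maybe using (Maybe; just; nothing; is-just)
import Data.Maybe.Properties as Maybe
open import Data.Product using (Σ; _×_; _,_; ∃; proj₁; proj₂)
open import Data.Sum using (_⊎_; inj₁; inj₂)
open import Data.List using (List; []; _∷_; length; filter; allFin; cartesianProduct)
import Data.List as List
open import Data.List.Membership.Propositional using (_∈_)
open import Data.List.Membership.Propositional.Properties
  using (∈-filter⁺; ∈-allFin; ∈-cartesianProduct⁺)
open import Data.List.Relation.Unary.Any using (here; there; index)
open import Data.List.Relation.Unary.Any.Properties using (lookup-index; ¬Any[])
open import Data.List.Relation.Unary.All using (All; []; _∷_) renaming (tail to All-tail)
open import Data.List.Relation.Unary.AllPairs using (AllPairs; _∷_)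
open import Data.List.Relation.Unary.Linked.Properties using (Linked⇒AllPairs)
open import Data.List.Relation.Binary.Permutation.Propositional using (↭-sym)
open import Data.List.Relation.Binary.Permutation.Propositional.Properties using (∈-resp-↭)
import Data.List.Sort as Sort
open import Relation.Binary.Bundles using (DecTotalOrder)
import Relation.Binary.Construct.On as On
import Relation.Binary.Construct.Flip.EqAndOrd as Flip
open import Data.List.Properties using (length-filter; length-tabulate)
open import Relation.Nullary using (¬_; Dec; yes; no; does; ¬?)
open import Relation.Nullary.Decidable using (dec-true; dec-false; decidable-stable; map′; _×-dec_; _⊎-dec_)
open import Relation.Unary using (Decidable)
open import Relation.Binary.PropositionalEquality
open import Data.Empty using (⊥-elim)

false≢true : false ≢ true
false≢true ()

∧-true : ∀ {a b} → a ∧ b ≡ true → a ≡ true × b ≡ true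
∧-true {true} e = refl , e

∧-intro : ∀ {a b} → a ≡ true → b ≡ true → a ∧ b ≡ true
∧-intro refl refl = refl

countIn : ∀ {n} → (Fin n → Bool) → List (Fin n) → ℕ
countIn p xs = length (filter (λ w → p w Bool.≟ true) xs)

countIn-mono : ∀ {n} {p q : Fin n → Bool} → (∀ w → p w ≡ true → q w ≡ true) →
               ∀ xs → countIn p xs ≤ countIn q xs
countIn-mono p⇒q [] = z≤n
countIn-mono {p = p} {q} p⇒q (x ∷ xs) with p x in px
... | true rewrite p⇒q x px = s≤s (countIn-mono p⇒q xs)
... | false with q x
...   | true  = m≤n⇒m≤1+n (countIn-mono p⇒q xs)
...   | false = countIn-mono p⇒q xs

countIn-mono-< : ∀ {n} {p q : Fin n → Bool} → (∀ w → p w ≡ true → q w ≡ true) →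
                 ∀ {y} xs → y ∈ xs → q y ≡ true → p y ≡ false → countIn p xs < countIn q xs
countIn-mono-< p⇒q (x ∷ xs) (here refl) qy py rewrite qy | py = s≤s (countIn-mono p⇒q xs)
countIn-mono-< {p = p} {q} p⇒q (x ∷ xs) (there y∈xs) qy py with p x in px
... | true rewrite p⇒q x px = s≤s (countIn-mono-< p⇒q xs y∈xs qy py)
... | false with q x
...   | true  = m≤n⇒m≤1+n (countIn-mono-< p⇒q xs y∈xs qy py)
...   | false = countIn-mono-< p⇒q xs y∈xs qy py

countIn-∨ : ∀ {n} (p q : Fin n → Bool) → ∀ xs → countIn (λ w → p w ∨ q w) xs ≤ countIn p xs + countIn q xs
countIn-∨ p q [] = z≤n
countIn-∨ p q (x ∷ xs) with p x | q x
... | true  | true  = s≤s (≤-trans (countIn-∨ p q xs) (≤-trans (n≤1+n _) (≤-reflexive (sym (+-suc _ _)))))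
... | true  | false = s≤s (countIn-∨ p q xs)
... | false | true  = ≤-trans (s≤s (countIn-∨ p q xs)) (≤-reflexive (sym (+-suc _ _)))
... | false | false = countIn-∨ p q xs

module _ {n : ℕ} where

  count-mono : {p q : Fin n → Bool} → (∀ w → p w ≡ true → q w ≡ true) → count p ≤ count q
  count-mono p⇒q = countIn-mono p⇒q (allFin n)

  count-mono-< : {p q : Fin n → Bool} → (∀ w → p w ≡ true → q w ≡ true) →
                 ∀ y → q y ≡ true → p y ≡ false → count p < count q
  count-mono-< p⇒q y = countIn-mono-< p⇒q (allFin n) (∈-allFin y)

  count-∨ : (p q : Fin n → Bool) → count (λ w → p w ∨ q w) ≤ count p + count q
  count-∨ p q = countIn-∨ p q (allFin n)

  count-≤ : (p : Fin n → Bool) → count p ≤ n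
  count-≤ p = ≤-trans (length-filter _ (allFin n)) (≤-reflexive (length-tabulate (λ x → x)))

  count-injection : ∀ {m} (p : Fin n → Bool) (f : Fin m → Fin n) →
                    (∀ i j → f i ≡ f j → i ≡ j) → (∀ i → p (f i) ≡ true) → m ≤ count p
  count-injection p f f-inj pf = injective⇒≤ {f = position} position-inj
    where
    sat : List (Fin n)
    sat = filter (λ w → p w Bool.≟ true) (allFin n)
    f∈sat : ∀ i → f i ∈ sat
    f∈sat i = ∈-filter⁺ (λ w → p w Bool.≟ true) (∈-allFin (f i)) (pf i)
    position : Fin _ → Fin (length sat)
    position i = index (f∈sat i)
    position-inj : ∀ {i j} → position i ≡ position j → i ≡ j
    position-inj {i} {j} e = f-inj i j (begin
      f i                         ≡⟨ lookup-index (f∈sat i) ⟩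
      List.lookup sat (position i) ≡⟨ cong (List.lookup sat) e ⟩
      List.lookup sat (position j) ≡⟨ lookup-index (f∈sat j) ⟨
      f j                         ∎)
      where open ≡-Reasoning

-- Arithmetic behind the degree count: (h-1) + h coloured partners, where
-- 2h ≤ m, are fewer than m.
halves-bound : ∀ {a b h m} → suc (suc a) ≤ h + 1 → suc b ≤ h + 1 → h * 2 ≤ m → a + b < m
halves-bound {a} {b} {h} {m} a+2≤ b+1≤ 2h≤m = begin-strict
  a + b  <⟨ +-monoˡ-< b (s≤s⁻¹ (subst (suc (suc a) ≤_) (+-comm h 1) a+2≤)) ⟩
  h + b  ≤⟨ +-monoʳ-≤ h (s≤s⁻¹ (subst (suc b ≤_) (+-comm h 1) b+1≤)) ⟩
  h + h  ≡⟨ cong (h +_) (sym (+-identityʳ h)) ⟩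
  2 * h  ≡⟨ *-comm 2 h ⟩
  h * 2  ≤⟨ 2h≤m ⟩
  m      ∎
  where open ≤-Reasoning

colour-used? : ∀ {n c} (col : Fin n → Maybe (Fin c)) → ∀ i → Dec (∃ λ w → col w ≡ just i)
colour-used? col i = any? (λ w → Maybe.≡-dec _≟_ (col w) (just i))

free-colour : ∀ {n c} (col : Fin n → Maybe (Fin c)) →
              count (λ w → is-just (col w)) < c → ∃ λ i → ∀ w → col w ≢ just i
free-colour {n} {c} col few with any? (λ i → ¬? (colour-used? col i))
... | yes (i , unused) = i , λ w coloured → unused (w , coloured)
... | no none = ⊥-elim (<⇒≱ few (count-injection _ witness witness-inj witness-coloured))
  where
  used : ∀ i → ∃ λ w → col w ≡ just i
  used i = decidable-stable (colour-used? col i) (λ unused → none (i , unused))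
  witness : Fin c → Fin n
  witness i = proj₁ (used i)
  witness-inj : ∀ i j → witness i ≡ witness j → i ≡ j
  witness-inj i j e = Maybe.just-injective
    (trans (sym (proj₂ (used i))) (trans (cong col e) (proj₂ (used j))))
  witness-coloured : ∀ i → is-just (col (witness i)) ≡ true
  witness-coloured i rewrite proj₂ (used i) = refl

module OneEdge {n c : ℕ} (G : Graph n) where

  edge-sym : ∀ {a b} → Edge G a b → Edge G b a
  edge-sym {a} {b} e = trans (adj-sym G b a) e

  edge-irrefl : ∀ {a} → ¬ Edge G a a
  edge-irrefl {a} e with trans (sym e) (adj-irr G a)
  ... | ()

  SamePair : Fin n → Fin n → Fin n → Fin n → Set
  SamePair x y a b = (a ≡ x × b ≡ y) ⊎ (a ≡ y × b ≡ x)

  samePair? : ∀ x y a b → Dec (SamePair x y a b)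
  samePair? x y a b = (a ≟ x ×-dec b ≟ y) ⊎-dec (a ≟ y ×-dec b ≟ x)

  samePair-swap : ∀ {x y a b} → SamePair x y a b → SamePair x y b a
  samePair-swap (inj₁ (a≡x , b≡y)) = inj₂ (b≡y , a≡x)
  samePair-swap (inj₂ (a≡y , b≡x)) = inj₁ (b≡x , a≡y)

  recolour : Labeling n c → Fin n → Fin n → Fin c → Labeling n c
  recolour L x y i = record { lab = new ; lab-sym = new-sym }
    where
    new : Fin n → Fin n → Maybe (Fin c)
    new a b with samePair? x y a b
    ... | yes _ = just i
    ... | no _  = lab L a b
    new-sym : ∀ a b → new a b ≡ new b a
    new-sym a b with samePair? x y a b | samePair? x y b a
    ... | yes _  | yes _  = refl
    ... | no _   | no _   = lab-sym L a b
    ... | yes ab | no ¬ba = ⊥-elim (¬ba (samePair-swap ab))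
    ... | no ¬ab | yes ba = ⊥-elim (¬ab (samePair-swap ba))

  recolour-lab : ∀ L x y i a b →
    (SamePair x y a b × lab (recolour L x y i) a b ≡ just i) ⊎
    (¬ SamePair x y a b × lab (recolour L x y i) a b ≡ lab L a b)
  recolour-lab L x y i a b with samePair? x y a b
  ... | yes ab = inj₁ (ab , refl)
  ... | no ¬ab = inj₂ (¬ab , refl)

  FreeAt : Labeling n c → Fin n → Fin n → Fin c → Set
  FreeAt L x y i = ∀ w → Edge G y w → w ≢ x → ¬ Edge G x w → lab L y w ≢ just i

  Free : Labeling n c → Fin n → Fin n → Fin c → Set
  Free L x y i = FreeAt L x y i × FreeAt L y x i

  free-closes : ∀ {L x y i w} → FreeAt L x y i → Edge G y w → w ≢ x →
                lab L y w ≡ just i → Edge G x w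
  free-closes {x = x} {w = w} free yw w≢x yw-i with adj G x w Bool.≟ true
  ... | yes xw = xw
  ... | no ¬xw = ⊥-elim (free w yw w≢x ¬xw yw-i)

  recolour-STC : ∀ {L x y i} → IsSTC G L → Edge G x y → Free L x y i → IsSTC G (recolour L x y i)
  recolour-STC {L} {x} {y} {i} stc xy (free-y , free-x) a b w j a≢w ab bw ab-j bw-j
    with recolour-lab L x y i a b | recolour-lab L x y i b w
  ... | inj₂ (_ , ab-old) | inj₂ (_ , bw-old) =
          stc a b w j a≢w ab bw (trans (sym ab-old) ab-j) (trans (sym bw-old) bw-j)
  ... | inj₁ (inj₁ (refl , refl) , _) | inj₁ (inj₁ (refl , refl) , _) = ⊥-elim (edge-irrefl xy)
  ... | inj₁ (inj₁ (refl , refl) , _) | inj₁ (inj₂ (_ , refl) , _)    = ⊥-elim (a≢w refl)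
  ... | inj₁ (inj₂ (refl , refl) , _) | inj₁ (inj₁ (_ , refl) , _)    = ⊥-elim (a≢w refl)
  ... | inj₁ (inj₂ (refl , refl) , _) | inj₁ (inj₂ (refl , _) , _)    = ⊥-elim (edge-irrefl xy)
  ... | inj₁ (ab-xy , ab-i) | inj₂ (_ , bw-old) with Maybe.just-injective (trans (sym ab-i) ab-j)
  ...   | refl with ab-xy
  ...     | inj₁ (refl , refl) = free-closes {L} free-y bw (λ w≡a → a≢w (sym w≡a)) (trans (sym bw-old) bw-j)
  ...     | inj₂ (refl , refl) = free-closes {L} free-x bw (λ w≡a → a≢w (sym w≡a)) (trans (sym bw-old) bw-j)
  recolour-STC {L} {x} {y} {i} stc xy (free-y , free-x) a b w j a≢w ab bw ab-j bw-j
      | inj₂ (_ , ab-old) | inj₁ (bw-xy , bw-i) with Maybe.just-injective (trans (sym bw-i) bw-j)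
  ...   | refl with bw-xy
  ...     | inj₁ (refl , refl) = edge-sym (free-closes {L} free-x (edge-sym ab) a≢w ba-i)
    where ba-i = trans (lab-sym L b a) (trans (sym ab-old) ab-j)
  ...     | inj₂ (refl , refl) = edge-sym (free-closes {L} free-y (edge-sym ab) a≢w ba-i)
    where ba-i = trans (lab-sym L b a) (trans (sym ab-old) ab-j)

  -- w is a P3-partner of the edge {x,y} at y: x–y–w is an induced P3.
  -- By definition p3Count G u v = count (partner u v) + count (partner v u).
  partner : Fin n → Fin n → Fin n → Bool
  partner x y w = adj G y w ∧ not (adj G x w) ∧ not (does (w ≟ x))

  partner-intro : ∀ {x y w} → Edge G y w → ¬ Edge G x w → w ≢ x → partner x y w ≡ true
  partner-intro {x} {y} {w} yw ¬xw w≢x rewrite yw | ¬-not ¬xw | dec-false (w ≟ x) w≢x = refl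

  labelled : Labeling n c → Fin n → Fin n → Fin n → Bool
  labelled L x y w = partner x y w ∧ is-just (lab L y w)

  conflict : Labeling n c → Fin n → Fin n → Fin n → Maybe (Fin c)
  conflict L x y w = if partner x y w then lab L y w else if partner y x w then lab L x w else nothing

  conflict-count : ∀ L x y → count (λ w → is-just (conflict L x y w)) ≤ count (labelled L x y) + count (labelled L y x)
  conflict-count L x y = ≤-trans (count-mono conflicting) (count-∨ (labelled L x y) (labelled L y x))
    where
    conflicting : ∀ w → is-just (conflict L x y w) ≡ true → labelled L x y w ∨ labelled L y x w ≡ true
    conflicting w e with partner x y w | partner y x w
    ... | true  | _    = cong (_∨ _) e
    ... | false | true = e

  unforbidden⇒free : ∀ {L x y i} → (∀ w → conflict L x y w ≢ just i) → Free L x y i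
  unforbidden⇒free {L} {x} {y} {i} allowed = free-y , free-x
    where
    free-y : FreeAt L x y i
    free-y w yw w≢x ¬xw yw-i = allowed w (trans conflict-y yw-i)
      where conflict-y : conflict L x y w ≡ lab L y w
            conflict-y rewrite partner-intro yw ¬xw w≢x = refl
    free-x : FreeAt L y x i
    free-x w xw w≢y ¬yw xw-i = allowed w (trans conflict-x xw-i)
      where conflict-x : conflict L x y w ≡ lab L x w
            conflict-x rewrite ¬-not ¬yw | xw | dec-false (w ≟ y) w≢y = refl

  free-for-edge : ∀ L x y → count (labelled L x y) + count (labelled L y x) < c → ∃ λ i → Free L x y i
  free-for-edge L x y few with free-colour (conflict L x y) (≤-<-trans (conflict-count L x y) few)
  ... | i , allowed = i , unforbidden⇒free {L} allowed

  labelled-≤-partner : ∀ L x y → count (labelled L x y) ≤ count (partner x y)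
  labelled-≤-partner L x y = count-mono {p = labelled L x y} (λ w e → proj₁ (∧-true e))

  -- y is a neighbour of x that is never a partner at x.
  labelled-<-degree : ∀ L {x y} → Edge G x y → count (labelled L y x) < count (adj G x)
  labelled-<-degree L {x} {y} xy = count-mono-< (λ w e → proj₁ (∧-true (proj₁ (∧-true e)))) y xy not-partner
    where not-partner : labelled L y x y ≡ false
          not-partner rewrite xy | adj-irr G y | dec-true (y ≟ y) refl = refl

  -- If moreover {y,z} (z ≠ x) is weak, two neighbours of y are no coloured partners.
  labelled-weak-<-degree : ∀ L {x y z} → Edge G y x → Edge G y z → z ≢ x → lab L y z ≡ nothing →
                           suc (count (labelled L x y)) < count (adj G y)
  labelled-weak-<-degree L {x} {y} {z} yx yz z≢x yz-weak =
    <-≤-trans (s≤s (count-mono-< labelled⇒other z other-z not-labelled-z))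
              (count-mono-< (λ w e → proj₁ (∧-true e)) x yx not-other-x)
    where
    other : Fin n → Bool
    other w = adj G y w ∧ not (does (w ≟ x))
    labelled⇒other : ∀ w → labelled L x y w ≡ true → other w ≡ true
    labelled⇒other w e with ∧-true {adj G y w} (proj₁ (∧-true {partner x y w} e))
    ... | yw , rest = ∧-intro yw (proj₂ (∧-true {not (adj G x w)} rest))
    other-z : other z ≡ true
    other-z rewrite yz | dec-false (z ≟ x) z≢x = refl
    not-labelled-z : labelled L x y z ≡ false
    not-labelled-z rewrite yz-weak = ∧-zeroʳ (partner x y z)
    not-other-x : other x ≡ false
    not-other-x rewrite dec-true (x ≟ x) refl = ∧-zeroʳ (adj G y x)

zero-or-suc : ∀ m → m ≡ 0 ⊎ ∃ λ l → m ≡ suc l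
zero-or-suc zero    = inj₁ refl
zero-or-suc (suc l) = inj₂ (l , refl)

-- The least k ≤ m with f k (or some value ≤ m if there is none): it
-- satisfies f, lies below every witness j ≤ m, and f fails below it.
least : ℕ → (ℕ → Bool) → ℕ
least zero    f = 0
least (suc m) f = if f 0 then 0 else suc (least m (λ k → f (suc k)))

least-holds : ∀ m (f : ℕ → Bool) j → f j ≡ true → j ≤ m → f (least m f) ≡ true × least m f ≤ j
least-holds zero    f .0 fj z≤n = fj , z≤n
least-holds (suc m) f j fj j≤m with f 0 in f0
... | true = f0 , z≤n
least-holds (suc m) f zero    fj j≤m       | false = ⊥-elim (false≢true (trans (sym f0) fj))
least-holds (suc m) f (suc j) fj (s≤s j≤m) | false with least-holds m (λ k → f (suc k)) j fj j≤m
... | holds , ≤j = holds , s≤s ≤j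

least-minimal : ∀ m (f : ℕ → Bool) i → i < least m f → f i ≡ false
least-minimal (suc m) f i i<least with f 0 in f0
least-minimal (suc m) f zero    _            | false = f0
least-minimal (suc m) f (suc i) (s≤s i<least) | false = least-minimal m (λ k → f (suc k)) i i<least

walk-end : ∀ {n} {G : Graph n} {P : Fin n → Set} {a b} → Reach G P a b → P b
walk-end (here pa)     = pa
walk-end (step _ _ pb) = pb

module BreadthFirst {n} (G : Graph n) {P : Fin n → Set} (P? : Decidable P) (source : Fin n → Bool) where

  reach : ℕ → Fin n → Bool
  reach zero    x = source x
  reach (suc k) x = reach k x ∨ (does (P? x) ∧ does (any? (λ z → (reach k z ∧ adj G z x) Bool.≟ true)))

  reach-old : ∀ k {x} → reach k x ≡ true → reach (suc k) x ≡ true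
  reach-old k e rewrite e = refl

  reach-new : ∀ k {x z} → P x → reach k z ≡ true → Edge G z x → reach (suc k) x ≡ true
  reach-new k {x} {z} px rz zx
    rewrite dec-true (P? x) px
          | dec-true (any? (λ z → (reach k z ∧ adj G z x) Bool.≟ true)) (z , ∧-intro rz zx)
    = ∨-zeroʳ (reach k x)

  reach-suc : ∀ k {x} → reach (suc k) x ≡ true →
              reach k x ≡ true ⊎ (P x × ∃ λ z → reach k z ≡ true × Edge G z x)
  reach-suc k {x} e with reach k x | P? x | any? (λ z → (reach k z ∧ adj G z x) Bool.≟ true)
  ... | true  | _      | _              = inj₁ refl
  ... | false | yes px | yes (z , rzx) = inj₂ (px , z , ∧-true rzx)

  reach-sound : ∀ {a} → (∀ s → source s ≡ true → Reach G P a s) →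
                ∀ k x → reach k x ≡ true → Reach G P a x
  reach-sound from-a zero    x e = from-a x e
  reach-sound from-a (suc k) x e with reach-suc k e
  ... | inj₁ old               = reach-sound from-a k x old
  ... | inj₂ (px , z , rz , zx) = step (reach-sound from-a k z rz) zx px

  reach-complete : ∀ {a x} → source a ≡ true → Reach G P a x → ∃ λ k → reach k x ≡ true
  reach-complete sa (here _) = 0 , sa
  reach-complete sa (step r zx px) with reach-complete sa r
  ... | k , rz = suc k , reach-new k px rz zx

  reach-from-0 : ∀ k {x} → source x ≡ true → reach k x ≡ true
  reach-from-0 zero    sx = sx
  reach-from-0 (suc k) sx = reach-old k (reach-from-0 k sx)

  Saturated : ℕ → Set
  Saturated k = ∀ x → reach (suc k) x ≡ true → reach k x ≡ true

  saturated-or-fresh : ∀ k → Saturated k ⊎ ∃ λ x → reach (suc k) x ≡ true × reach k x ≡ false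
  saturated-or-fresh k with any? (λ x → (reach (suc k) x Bool.≟ true) ×-dec (reach k x Bool.≟ false))
  ... | yes fresh = inj₂ fresh
  ... | no none   = inj₁ saturated
    where
    saturated : Saturated k
    saturated x e with reach k x Bool.≟ true
    ... | yes old = old
    ... | no ¬old = ⊥-elim (none (x , e , ¬-not ¬old))

  -- Until saturation every round reaches a new vertex, so after k rounds
  -- at least k vertices are reached.
  saturation-or-growth : ∀ k → Σ ℕ Saturated ⊎ k ≤ count (reach k)
  saturation-or-growth zero = inj₂ z≤n
  saturation-or-growth (suc k) with saturation-or-growth k | saturated-or-fresh k
  ... | inj₁ sat | _                         = inj₁ sat
  ... | inj₂ _   | inj₁ sat                  = inj₁ (k , sat)
  ... | inj₂ k≤  | inj₂ (x , new , not-old) =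
          inj₂ (<-≤-trans (s≤s k≤) (count-mono-< (λ _ → reach-old k) x new not-old))

  -- Since at most n vertices exist, some round ≤ n+1 is saturated.
  saturation : Σ ℕ Saturated
  saturation with saturation-or-growth (suc n)
  ... | inj₁ sat  = sat
  ... | inj₂ n<   = ⊥-elim (<⇒≱ n< (count-≤ (reach (suc n))))

  K : ℕ
  K = proj₁ saturation

  reach-K : ∀ k x → reach k x ≡ true → reach K x ≡ true
  reach-K zero    x e = reach-from-0 K e
  reach-K (suc k) x e with reach-suc k e
  ... | inj₁ old               = reach-K k x old
  ... | inj₂ (px , z , rz , zx) = proj₂ saturation x (reach-new K px (reach-K k z rz) zx)

  level : Fin n → ℕ
  level x = least K (λ k → reach k x)

  level-source : ∀ {x} → source x ≡ true → level x ≡ 0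
  level-source {x} sx with least-holds K (λ k → reach k x) 0 sx z≤n
  ... | _ , ≤0 = n≤0⇒n≡0 ≤0

  level-zero : ∀ {x} → reach K x ≡ true → level x ≡ 0 → source x ≡ true
  level-zero {x} rx l≡0 with least-holds K (λ k → reach k x) K rx ≤-refl
  ... | holds , _ rewrite l≡0 = holds

  level-descend : ∀ {x l} → reach K x ≡ true → level x ≡ suc l →
                  ∃ λ z → reach K z ≡ true × Edge G z x × level z ≤ l
  level-descend {x} {l} rx lx = descend (reach-suc l reached)
    where
    first : reach (level x) x ≡ true × level x ≤ K
    first = least-holds K (λ k → reach k x) K rx ≤-refl
    reached : reach (suc l) x ≡ true
    reached = subst (λ k → reach k x ≡ true) lx (proj₁ first)
    not-before : reach l x ≡ false
    not-before = least-minimal K (λ k → reach k x) l (subst (l <_) (sym lx) ≤-refl)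
    l≤K : l ≤ K
    l≤K = ≤-trans (n≤1+n l) (subst (_≤ K) lx (proj₂ first))
    descend : reach l x ≡ true ⊎ (P x × ∃ λ z → reach l z ≡ true × Edge G z x) →
              ∃ λ z → reach K z ≡ true × Edge G z x × level z ≤ l
    descend (inj₁ old)               = ⊥-elim (false≢true (trans (sym not-before) old))
    descend (inj₂ (_ , z , rz , zx)) =
      z , reach-K l z rz , zx , proj₂ (least-holds K (λ k → reach k z) l rz l≤K)

module Greedy {n} (G : Graph n) (c : ℕ) (D : EdgeSubset G) (valid : ValidD G c D)
              (A : Fin n → Set) (comp : PeripheryComponent G D A)
              (u v : Fin n) (uv : Edge G u v) (Au : A u) (Av : A v)
              (fewP3 : p3Count G u v < c) where

  open PeripheryComponent comp
  open OneEdge {n} {c} G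

  periphery? : Decidable (InPeriphery D)
  periphery? x = ¬? (any? (λ w → mem D x w Bool.≟ true))

  isSource : Fin n → Bool
  isSource x = does (x ≟ u) ∨ does (x ≟ v)

  open BreadthFirst G periphery? isSource

  source-u : isSource u ≡ true
  source-u rewrite dec-true (u ≟ u) refl = refl

  source-v : isSource v ≡ true
  source-v rewrite dec-true (v ≟ v) refl = ∨-zeroʳ (does (v ≟ u))

  source-cases : ∀ {x} → isSource x ≡ true → x ≡ u ⊎ x ≡ v
  source-cases {x} e with x ≟ u | x ≟ v
  ... | yes x≡u | _      = inj₁ x≡u
  ... | no _    | yes x≡v = inj₂ x≡v

  reach⇒A : ∀ {x} → reach K x ≡ true → A x
  reach⇒A {x} rx = maximal u x Au (walk-end walk) walk
    where
    from-u : ∀ s → isSource s ≡ true → Reach G (InPeriphery D) u s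
    from-u s e with source-cases {s} e
    ... | inj₁ refl = here (sub u Au)
    ... | inj₂ refl = step (here (sub u Au)) uv (sub v Av)
    walk : Reach G (InPeriphery D) u x
    walk = reach-sound from-u K x rx

  A⇒reach : ∀ {x} → A x → reach K x ≡ true
  A⇒reach {x} ax with reach-complete source-u (connected u x Au ax)
  ... | k , rx = reach-K k x rx

  A? : Decidable A
  A? x = map′ reach⇒A A⇒reach (reach K x Bool.≟ true)

  -- No D-edge touches A, so every vertex of A has degree ≤ ⌊c/2⌋+1.
  degree-bound : ∀ {x} → A x → count (adj G x) ≤ c / 2 + 1
  degree-bound {x} ax = ≤-trans (count-mono {p = adj G x} kept) (valid x)
    where
    kept : ∀ w → adj G x w ≡ true → adj G x w ∧ not (mem D x w) ≡ true
    kept w xw rewrite xw | ¬-not (λ m → sub x ax (w , m)) = refl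

  rank : Fin n → Fin n → ℕ
  rank x y = level x + level y

  rank-sym : ∀ x y → rank x y ≡ rank y x
  rank-sym x y = +-comm (level x) (level y)

  level-zero-cases : ∀ {x} → A x → level x ≡ 0 → x ≡ u ⊎ x ≡ v
  level-zero-cases ax l≡0 = source-cases (level-zero (A⇒reach ax) l≡0)

  partner-source : ∀ {y} → y ≡ u ⊎ y ≡ v → ∃ λ z → A z × Edge G y z × level z ≡ 0
  partner-source (inj₁ refl) = v , Av , uv , level-source source-v
  partner-source (inj₂ refl) = u , Au , edge-sym uv , level-source source-u

  lower-edge : ∀ {x y} → A x → A y → level y ≤ level x → 0 < level x →
               ∃ λ z → A z × Edge G y z × z ≢ x × rank y z < rank x y
  lower-edge {x} {y} ax ay ly≤lx 0<lx with zero-or-suc (level y)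
  ... | inj₁ ly with partner-source (level-zero-cases ay ly)
  ...   | z , az , yz , lz = z , az , yz , z≢x , rank-yz
    where
    z≢x : z ≢ x
    z≢x refl = <-irrefl (sym lz) 0<lx
    rank-yz : rank y z < rank x y
    rank-yz = begin-strict
      rank y z  ≡⟨ cong₂ _+_ ly lz ⟩
      0         <⟨ 0<lx ⟩
      level x   ≤⟨ m≤m+n (level x) (level y) ⟩
      rank x y  ∎
      where open ≤-Reasoning
  lower-edge {x} {y} ax ay ly≤lx 0<lx | inj₂ (l , ly) with level-descend (A⇒reach ay) ly
  ... | z , rz , zy , lz≤l = z , reach⇒A rz , edge-sym zy , z≢x , rank-yz
    where
    lz<lx : level z < level x
    lz<lx = <-≤-trans (subst (level z <_) (sym ly) (s≤s lz≤l)) ly≤lx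
    z≢x : z ≢ x
    z≢x refl = <-irrefl refl lz<lx
    rank-yz : rank y z < rank x y
    rank-yz = subst (rank y z <_) (rank-sym y x) (+-monoʳ-< (level y) lz<lx)

  WeakBelow : Labeling n c → Fin n → Fin n → Set
  WeakBelow L x y = ∀ a b → Edge G a b → A a → A b → rank a b < rank x y → lab L a b ≡ nothing

  source-edge-bound : ∀ L → count (labelled L u v) + count (labelled L v u) < c
  source-edge-bound L = ≤-<-trans (+-mono-≤ (labelled-≤-partner L u v) (labelled-≤-partner L v u)) fewP3

  -- The bound when y is the end of lower level: for {u,v} it is the
  -- hypothesis; otherwise `lower-edge` yields a weak edge at y, and the
  -- degree bound applies at both ends.
  few-conflicts-oriented : ∀ L {x y} → Edge G x y → A x → A y → WeakBelow L x y → level y ≤ level x →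
                           count (labelled L x y) + count (labelled L y x) < c
  few-conflicts-oriented L {x} {y} xy ax ay weak ly≤lx with zero-or-suc (level x)
  ... | inj₁ lx with level-zero-cases ax lx | level-zero-cases ay (n≤0⇒n≡0 (subst (level y ≤_) lx ly≤lx))
  ...   | inj₁ refl | inj₁ refl = ⊥-elim (edge-irrefl xy)
  ...   | inj₁ refl | inj₂ refl = source-edge-bound L
  ...   | inj₂ refl | inj₁ refl = subst (_< c) (+-comm (count (labelled L u v)) _) (source-edge-bound L)
  ...   | inj₂ refl | inj₂ refl = ⊥-elim (edge-irrefl xy)
  few-conflicts-oriented L {x} {y} xy ax ay weak ly≤lx | inj₂ (l , lx)
    with lower-edge ax ay ly≤lx (subst (0 <_) (sym lx) z<s)
  ... | z , az , yz , z≢x , below =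
    halves-bound
      (≤-trans (labelled-weak-<-degree L (edge-sym xy) yz z≢x (weak y z yz ay az below)) (degree-bound ay))
      (≤-trans (labelled-<-degree L xy) (degree-bound ax))
      (m/n*n≤m c 2)

  few-conflicts : ∀ L {x y} → Edge G x y → A x → A y → WeakBelow L x y →
                  count (labelled L x y) + count (labelled L y x) < c
  few-conflicts L {x} {y} xy ax ay weak with ≤-total (level y) (level x)
  ... | inj₁ ly≤lx = few-conflicts-oriented L xy ax ay weak ly≤lx
  ... | inj₂ lx≤ly = subst (_< c) (+-comm (count (labelled L y x)) _)
                       (few-conflicts-oriented L (edge-sym xy) ay ax weak′ lx≤ly)
    where
    weak′ : WeakBelow L y x
    weak′ a b ab aa ab′ below = weak a b ab aa ab′ (subst (rank a b <_) (rank-sym y x) below)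

  colour-step : ∀ L {x y} → Edge G x y → A x → A y → WeakBelow L x y → ∃ λ i → Free L x y i
  colour-step L {x} {y} xy ax ay weak = free-for-edge L x y (few-conflicts L xy ax ay weak)

  Pair : Set
  Pair = Fin n × Fin n

  pairRank : Pair → ℕ
  pairRank (x , y) = rank x y

  byDecreasingRank : DecTotalOrder _ _ _
  byDecreasingRank = On.decTotalOrder (Flip.decTotalOrder ≤-decTotalOrder) pairRank

  open Sort byDecreasingRank using (sort; sort-↭; sort-↗)

  Descending : List Pair → Set
  Descending = AllPairs (λ p q → pairRank q ≤ pairRank p)

  allPairs : List Pair
  allPairs = cartesianProduct (allFin n) (allFin n)

  sortedPairs : List Pair
  sortedPairs = sort allPairs

  sortedPairs-descending : Descending sortedPairs
  sortedPairs-descending = Linked⇒AllPairs (λ q≤p r≤q → ≤-trans r≤q q≤p) (sort-↗ allPairs)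

  WeakEdge : Labeling n c → Fin n → Fin n → Set
  WeakEdge L x y = Edge G x y × A x × A y × lab L x y ≡ nothing

  weak? : ∀ L x y → Dec (WeakEdge L x y)
  weak? L x y = (adj G x y Bool.≟ true) ×-dec A? x ×-dec A? y ×-dec Maybe.≡-dec _≟_ (lab L x y) nothing

  record Progress (L L′ : Labeling n c) (pending : List Pair) : Set where
    field
      stc          : IsSTC G L′
      outside      : PartiallyEqualOutside G A L L′
      weak-pending : ∀ x y → WeakEdge L′ x y → (x , y) ∈ pending
      coloured-top : ∀ x y → Edge G x y → A x → A y → lab L′ x y ≢ nothing →
                     All (λ p → pairRank p ≤ rank x y) pending
  open Progress

  start : ∀ L → IsSTC G L → (∀ x y → Edge G x y → A x → A y → lab L x y ≡ nothing) →
          Progress L L sortedPairs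
  start L stcL weakL = record
    { stc          = stcL
    ; outside      = λ _ _ _ _ → refl
    ; weak-pending = λ x y _ → ∈-resp-↭ (↭-sym (sort-↭ allPairs)) (∈-cartesianProduct⁺ (∈-allFin x) (∈-allFin y))
    ; coloured-top = λ x y xy ax ay coloured → ⊥-elim (coloured (weakL x y xy ax ay))
    }

  weak-below : ∀ {L L′ x y pending} → Progress L L′ ((x , y) ∷ pending) → WeakBelow L′ x y
  weak-below {L′ = L′} prog a b ab aa ab′ below with Maybe.≡-dec _≟_ (lab L′ a b) nothing
  ... | yes weak     = weak
  ... | no coloured with coloured-top prog a b ab aa ab′ coloured
  ...   | top ∷ _ = ⊥-elim (<⇒≱ below top)

  skip : ∀ {L L′ x y pending} → Progress L L′ ((x , y) ∷ pending) → ¬ WeakEdge L′ x y →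
         Progress L L′ pending
  skip {L′ = L′} {pending = pending} prog not-weak = record
    { stc          = stc prog
    ; outside      = outside prog
    ; weak-pending = pending-tail
    ; coloured-top = λ a b ab aa ab′ coloured → All-tail (coloured-top prog a b ab aa ab′ coloured)
    }
    where
    pending-tail : ∀ a b → WeakEdge L′ a b → (a , b) ∈ pending
    pending-tail a b weak with weak-pending prog a b weak
    ... | here refl   = ⊥-elim (not-weak weak)
    ... | there later = later

  colour : ∀ {L L′ x y i pending} → Progress L L′ ((x , y) ∷ pending) →
           Edge G x y → A x → A y → Free L′ x y i →
           All (λ p → pairRank p ≤ rank x y) pending →
           Progress L (recolour L′ x y i) pending
  colour {L} {L′} {x} {y} {i} {pending} prog xy ax ay free top = record
    { stc          = recolour-STC {L′} (stc prog) xy free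
    ; outside      = outside′
    ; weak-pending = weak-pending′
    ; coloured-top = coloured-top′
    }
    where
    outside′ : PartiallyEqualOutside G A L (recolour L′ x y i)
    outside′ a b ab not-in-A with recolour-lab L′ x y i a b
    ... | inj₁ (inj₁ (refl , refl) , _) = ⊥-elim (not-in-A (ax , ay))
    ... | inj₁ (inj₂ (refl , refl) , _) = ⊥-elim (not-in-A (ay , ax))
    ... | inj₂ (_ , unchanged)          = trans (outside prog a b ab not-in-A) (sym unchanged)
    weak-pending′ : ∀ a b → WeakEdge (recolour L′ x y i) a b → (a , b) ∈ pending
    weak-pending′ a b (ab , aa , ab′ , weak) with recolour-lab L′ x y i a b
    ... | inj₁ (_ , coloured) with trans (sym weak) coloured
    ...   | ()
    weak-pending′ a b (ab , aa , ab′ , weak) | inj₂ (not-xy , unchanged)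
      with weak-pending prog a b (ab , aa , ab′ , trans (sym unchanged) weak)
    ... | here refl   = ⊥-elim (not-xy (inj₁ (refl , refl)))
    ... | there later = later
    coloured-top′ : ∀ a b → Edge G a b → A a → A b → lab (recolour L′ x y i) a b ≢ nothing →
                    All (λ p → pairRank p ≤ rank a b) pending
    coloured-top′ a b ab aa ab′ coloured with recolour-lab L′ x y i a b
    ... | inj₁ (inj₁ (refl , refl) , _) = top
    ... | inj₁ (inj₂ (refl , refl) , _) = subst (λ r → All (λ p → pairRank p ≤ r) pending) (rank-sym x y) top
    ... | inj₂ (_ , unchanged)          =
            All-tail (coloured-top prog a b ab aa ab′ (λ weak → coloured (trans unchanged weak)))

  Completion : Labeling n c → Set
  Completion L = Σ (Labeling n c) λ L′ → IsSTC G L′ × PartiallyEqualOutside G A L L′ ×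
                   (∀ x y → Edge G x y → A x → A y → lab L′ x y ≢ nothing)

  greedy : ∀ L L′ pending → Descending pending → Progress L L′ pending → Completion L
  greedy L L′ [] _ prog =
    L′ , stc prog , outside prog , λ x y xy ax ay weak → ¬Any[] (weak-pending prog x y (xy , ax , ay , weak))
  greedy L L′ ((x , y) ∷ pending) (top ∷ descending) prog with weak? L′ x y
  ... | no not-weak = greedy L L′ pending descending (skip prog not-weak)
  ... | yes (xy , ax , ay , _) with colour-step L′ xy ax ay (weak-below prog)
  ...   | i , free = greedy L (recolour L′ x y i) pending descending (colour prog xy ax ay free top)

proposition23 : ∀ {n} (G : Graph n) (c k : ℕ) (D : EdgeSubset G) → ValidD G c D → (A : Fin n → Set) → PeripheryComponent G D A → (u v : Fin n) → Edge G u v → A u → A v → p3Count G u v < c → Good G c A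
proposition23 G c k D valid A comp u v uv Au Av fewP3 L stcL weakL =
  greedy L L sortedPairs sortedPairs-descending (start L stcL weakL)
  where open Greedy G c D valid A comp u v uv Au Av fewP3
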